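{- For every two graphs $H$ and $G$ such that $H$ is connected and has at least one edge, $\mathrm{pack}_{H^+}(G^*)\leq \mathrm{pack}_H(G)$.
   Context: Graphs are finite, loopless, may have multiple edges; $\mathrm{mdeg}_G(v)$ is the number of edges incident with $v$ counting multiplicities. $G$ contains $H$ as an immersion if there is $(\phi,\psi)$ with $\phi:V(H)\to V(G)$ injective and $\psi$ mapping each edge of $H$ (each copy of a multiple edge separately) with endpoints $u,v$ to a path of $G$ between $\phi(u),\phi(v)$, distinct edges going to edge-disjoint paths; the $H$-immersion expansion is the subgraph formed by $\phi(V(H))$ and the vertices and edges of these paths. $\mathrm{pack}_H(G)$ is the maximum number of pairwise edge-disjoint $H$-immersion expansions in $G$. $H^+$ is obtained from $H$ by adding, for every vertex $v$, new vertices $v',v''$, an edge $\{v',v''\}$ of multiplicity 2, and edges $\{v,v'\},\{v,v''\}$ of multiplicity 1. $G^*$ is obtained from $G$ by adding, for every vertex $v$ and every $i\in\{1,\dots,\mathrm{mdeg}_G(v)\}$, new vertices $v'_i,v''_i$, an edge $\{v'_i,v''_i\}$ of multiplicity 2, and edges $\{v,v'_i\},\{v,v''_i\}$ of multiplicity 1. -}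

module Defs where

open import Data.Nat using (ℕ; zero; suc; _+_; _*_; _≤_)
open import Data.Fin using (Fin; zero; suc; _↑ˡ_; _↑ʳ_; splitAt; remQuot; inject₁; fromℕ; _≟_)
open import Data.Product using (Σ; _×_; _,_; proj₁; proj₂)
open import Data.Sum using (_⊎_; inj₁; inj₂)
open import Data.Bool using (Bool; true; false; _∨_; if_then_else_)
open import Data.Empty using (⊥)
open import Relation.Nullary using (¬_)
open import Relation.Nullary.Decidable using (⌊_⌋)
open import Relation.Binary.PropositionalEquality using (_≡_; _≢_)

-- Finite multigraphs: vertices Fin V, edges Fin E, each edge has an
-- (unordered, we record an arbitrary orientation) pair of endpoints.
-- Parallel edges = distinct edge indices with the same endpoints.

record Graph : Set where
  field
    V    : ℕ
    E    : ℕ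
    ends : Fin E → Fin V × Fin V

open Graph public

Loopless : Graph → Set
Loopless G = ∀ (e : Fin (E G)) → proj₁ (ends G e) ≢ proj₂ (ends G e)

Joins : (G : Graph) → Fin (E G) → Fin (V G) → Fin (V G) → Set
Joins G e a b = (ends G e ≡ (a , b)) ⊎ (ends G e ≡ (b , a))

record Path (G : Graph) (u v : Fin (V G)) : Set where
  field
    len      : ℕ
    verts    : Fin (suc len) → Fin (V G)
    edges    : Fin len → Fin (E G)
    start    : verts zero ≡ u
    end      : verts (fromℕ len) ≡ v
    joins    : ∀ (i : Fin len) → Joins G (edges i) (verts (inject₁ i)) (verts (suc i))
    distinct : ∀ (i j : Fin (suc len)) → verts i ≡ verts j → i ≡ j

open Path public

Connected : Graph → Set
Connected G = ∀ (u v : Fin (V G)) → Path G u v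

record Immersion (H G : Graph) : Set where
  field
    φ        : Fin (V H) → Fin (V G)
    φ-inj    : ∀ (a b : Fin (V H)) → φ a ≡ φ b → a ≡ b
    ψ        : (e : Fin (E H)) → Path G (φ (proj₁ (ends H e))) (φ (proj₂ (ends H e)))
    disjoint : ∀ (e f : Fin (E H)) (i : Fin (len (ψ e))) (j : Fin (len (ψ f))) →
               edges (ψ e) i ≡ edges (ψ f) j → e ≡ f

open Immersion public

InExpansion : {H G : Graph} → Immersion H G → Fin (E G) → Set
InExpansion {H} I x = Σ (Fin (E H)) λ e → Σ (Fin (len (ψ I e))) λ i → edges (ψ I e) i ≡ x

EdgeDisjoint : {H G : Graph} → Immersion H G → Immersion H G → Set
EdgeDisjoint {H} {G} I J = ∀ (x : Fin (E G)) → InExpansion I x → InExpansion J x → ⊥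

Packing : Graph → Graph → ℕ → Set
Packing H G k = Σ (Fin k → Immersion H G) λ I →
  ∀ (a b : Fin k) → a ≢ b → EdgeDisjoint (I a) (I b)

IsPack : Graph → Graph → ℕ → Set
IsPack H G p = Packing H G p × (∀ (k : ℕ) → Packing H G k → k ≤ p)

-- Gadgets. attach G D own : for every g : Fin D add new vertices g', g'',
-- an edge {g',g''} of multiplicity 2 and edges {own g, g'}, {own g, g''}.
-- Vertices: v ↦ v ↑ˡ (D + D), g' = V ↑ʳ (g ↑ˡ D), g'' = V ↑ʳ (D ↑ʳ g).

gadgetEdge : ∀ {V D} → (Fin D → Fin V) → Fin D → Fin 4 → Fin (V + (D + D)) × Fin (V + (D + D))
gadgetEdge {V} {D} own g j with j
... | zero                   = (V ↑ʳ (g ↑ˡ D) , V ↑ʳ (D ↑ʳ g))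
... | suc zero               = (V ↑ʳ (g ↑ˡ D) , V ↑ʳ (D ↑ʳ g))
... | suc (suc zero)         = (own g ↑ˡ (D + D) , V ↑ʳ (g ↑ˡ D))
... | suc (suc (suc zero))   = (own g ↑ˡ (D + D) , V ↑ʳ (D ↑ʳ g))

attach : (G : Graph) (D : ℕ) → (Fin D → Fin (V G)) → Graph
attach G D own = record
  { V    = V G + (D + D)
  ; E    = E G + D * 4
  ; ends = λ x → f (splitAt (E G) x)
  }
  where
  f : Fin (E G) ⊎ Fin (D * 4) → Fin (V G + (D + D)) × Fin (V G + (D + D))
  f (inj₁ e) = (proj₁ (ends G e) ↑ˡ (D + D) , proj₂ (ends G e) ↑ˡ (D + D))
  f (inj₂ y) = gadgetEdge own (proj₁ (remQuot {D} 4 y)) (proj₂ (remQuot {D} 4 y))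

_⁺ : Graph → Graph
H ⁺ = attach H (V H) (λ v → v)

ΣFin : (n : ℕ) → (Fin n → ℕ) → ℕ
ΣFin zero    f = 0
ΣFin (suc n) f = f zero + ΣFin n (λ i → f (suc i))

unflatten : (n : ℕ) (f : Fin n → ℕ) → Fin (ΣFin n f) → Σ (Fin n) (λ v → Fin (f v))
unflatten zero    f ()
unflatten (suc n) f x with splitAt (f zero) x
... | inj₁ i = (zero , i)
... | inj₂ y with unflatten n (λ i → f (suc i)) y
...   | (v , i) = (suc v , i)

incident : (G : Graph) → Fin (V G) → Fin (E G) → Bool
incident G v e = ⌊ proj₁ (ends G e) ≟ v ⌋ ∨ ⌊ proj₂ (ends G e) ≟ v ⌋

mdeg : (G : Graph) → Fin (V G) → ℕ
mdeg G v = ΣFin (E G) (λ e → if incident G v e then 1 else 0)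

-- G* : for every v and every i ∈ {1..mdeg v} one gadget attached at v;
-- gadgets are indexed by Fin (Σ_v mdeg v) ≅ Σ (v : Fin V) Fin (mdeg v).
_* : Graph → Graph
G * = attach G (ΣFin (V G) (mdeg G)) (λ g → proj₁ (unflatten (V G) (mdeg G) g))

module Submission where

-- An H⁺-immersion in G* restricts to an H-immersion in G, and edge-disjoint immersions restrict
-- to edge-disjoint ones.  The point is that the vertices of H are mapped into G.  In H⁺ a vertex v
-- has three edges, to v′, v″ and a neighbour w in H, and each of these targets has a further edge
-- (v′v″, v″v′, wv′).  A gadget vertex, however, has only three edges, two of them parallel to its
-- twin: two of the three image paths leave through the twin, whose single remaining edge can carry
-- only one of them on, so the other ends at the twin, and the image path of that target's further
-- edge finds every edge at the twin used.  Once the ends are in G, a path cannot visit a gadget,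
-- as it could only enter and leave it through the vertex the gadget hangs from.

open import Defs
open import Data.Nat using (ℕ; zero; suc; _+_; _*_; _∸_; _≤_; z≤n; s≤s; _≤?_)
open import Data.Nat.Properties using (<⇒≤; m≤n⇒m<n∨m≡n; m∸n≤m; n∸n≡0; ∸-cancelˡ-≡; +-∸-assoc; m≢1+n+m)
open import Data.Fin using (Fin; zero; suc; toℕ; fromℕ; fromℕ<; inject₁; _↑ˡ_; _↑ʳ_; splitAt; remQuot; combine; _≟_)
open import Data.Fin.Patterns using (0F; 1F; 2F; 3F)
open import Data.Fin.Properties using (toℕ-fromℕ; toℕ-fromℕ<; toℕ-inject₁; toℕ≤pred[n]; splitAt-↑ˡ; splitAt-↑ʳ; splitAt⁻¹-↑ˡ; splitAt⁻¹-↑ʳ; remQuot-combine; combine-remQuot; combine-injective; ↑ˡ-injective; ↑ʳ-injective)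
open import Data.Product using (Σ; _×_; _,_; proj₁; proj₂; swap)
open import Data.Sum using (_⊎_; inj₁; inj₂)
import Data.Sum as Sum
open import Data.Empty using (⊥; ⊥-elim)
open import Function using (_∘_)
open import Relation.Nullary using (¬_; Dec; yes; no)
open import Relation.Nullary.Decidable using (recompute)
open import Relation.Binary.PropositionalEquality

Joins-sym : ∀ {G e a b} → Joins G e a b → Joins G e b a
Joins-sym (inj₁ eq) = inj₂ eq
Joins-sym (inj₂ eq) = inj₁ eq

Joins-cong : ∀ {G x x′ a a′ b b′} → x ≡ x′ → a ≡ a′ → b ≡ b′ → Joins G x a b → Joins G x′ a′ b′
Joins-cong refl refl refl J = J

Joins-ends : ∀ {G e a b pr} → ends G e ≡ pr → Joins G e a b → pr ≡ (a , b) ⊎ pr ≡ (b , a)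
Joins-ends eq = Sum.map (trans (sym eq)) (trans (sym eq))

Joins-irrefl : ∀ {G e a b} → Loopless G → Joins G e a b → a ≢ b
Joins-irrefl loopless (inj₁ eq) refl = loopless _ (trans (cong proj₁ eq) (sym (cong proj₂ eq)))
Joins-irrefl loopless (inj₂ eq) refl = loopless _ (trans (cong proj₁ eq) (sym (cong proj₂ eq)))

Joins-functional : ∀ {G e a b c} → a ≢ b → Joins G e a b → Joins G e a c → b ≡ c
Joins-functional _   (inj₁ eb) (inj₁ ec) = cong proj₂ (trans (sym eb) ec)
Joins-functional a≢b (inj₁ eb) (inj₂ ec) = ⊥-elim (a≢b (sym (cong proj₂ (trans (sym eb) ec))))
Joins-functional a≢b (inj₂ eb) (inj₁ ec) = ⊥-elim (a≢b (sym (cong proj₁ (trans (sym eb) ec))))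
Joins-functional _   (inj₂ eb) (inj₂ ec) = cong proj₁ (trans (sym eb) ec)

-- Out-of-range indices read the last entry.
lookupℕ : ∀ {A : Set} n → (Fin (suc n) → A) → ℕ → A
lookupℕ n       f zero    = f zero
lookupℕ zero    f (suc k) = f zero
lookupℕ (suc n) f (suc k) = lookupℕ n (f ∘ suc) k

lookupℕ-toℕ : ∀ {A : Set} n (f : Fin (suc n) → A) (j : Fin (suc n)) → lookupℕ n f (toℕ j) ≡ f j
lookupℕ-toℕ n       f zero    = refl
lookupℕ-toℕ zero    f (suc ())
lookupℕ-toℕ (suc n) f (suc j) = lookupℕ-toℕ n (f ∘ suc) j

-- Paths re-indexed by ℕ, so that consecutive positions are i and suc i rather than inject₁ i and suc i.
record ℕPath (G : Graph) (s t : Fin (V G)) : Set where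
  field
    length           : ℕ
    vertex           : ℕ → Fin (V G)
    edge             : (i : ℕ) → .(suc i ≤ length) → Fin (E G)
    vertex-0         : vertex 0 ≡ s
    vertex-length    : vertex length ≡ t
    edge-joins       : ∀ i .(p : suc i ≤ length) → Joins G (edge i p) (vertex i) (vertex (suc i))
    vertex-injective : ∀ i j → i ≤ length → j ≤ length → vertex i ≡ vertex j → i ≡ j

open ℕPath public

fromPath : ∀ {G s t} → Path G s t → ℕPath G s t
fromPath {G} P = record
  { length           = len P
  ; vertex           = vertexℕ
  ; edge             = λ i p → edges P (fromℕ< p)
  ; vertex-0         = start P
  ; vertex-length    = trans (vertexℕ-toℕ (fromℕ (len P)) (toℕ-fromℕ (len P))) (end P)
  ; edge-joins       = λ i p → subst₂ (Joins G (edges P (fromℕ< p)))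
                         (sym (vertexℕ-toℕ (inject₁ (fromℕ< p)) (trans (toℕ-inject₁ (fromℕ< p)) (toℕ-fromℕ< p))))
                         (sym (vertexℕ-toℕ (suc (fromℕ< p)) (cong suc (toℕ-fromℕ< p))))
                         (joins P (fromℕ< p))
  ; vertex-injective = injective
  }
  where
  vertexℕ : ℕ → Fin (V G)
  vertexℕ = lookupℕ (len P) (verts P)

  vertexℕ-toℕ : ∀ {k} j → toℕ j ≡ k → vertexℕ k ≡ verts P j
  vertexℕ-toℕ j refl = lookupℕ-toℕ (len P) (verts P) j

  injective : ∀ i j → i ≤ len P → j ≤ len P → vertexℕ i ≡ vertexℕ j → i ≡ j
  injective i j i≤ j≤ eq = begin
    i                        ≡⟨ toℕ-fromℕ< (s≤s i≤) ⟨
    toℕ (fromℕ< (s≤s i≤))   ≡⟨ cong toℕ (distinct P _ _ (trans (sym (vertexℕ-toℕ _ (toℕ-fromℕ< (s≤s i≤))))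
                                 (trans eq (vertexℕ-toℕ _ (toℕ-fromℕ< (s≤s j≤)))))) ⟩
    toℕ (fromℕ< (s≤s j≤))   ≡⟨ toℕ-fromℕ< (s≤s j≤) ⟩
    j                        ∎
    where open ≡-Reasoning

castEnds : ∀ {G s t s′ t′} → s ≡ s′ → t ≡ t′ → ℕPath G s t → ℕPath G s′ t′
castEnds s≡s′ t≡t′ P = record
  { length = length P ; vertex = vertex P ; edge = edge P
  ; vertex-0 = trans (vertex-0 P) s≡s′ ; vertex-length = trans (vertex-length P) t≡t′
  ; edge-joins = edge-joins P ; vertex-injective = vertex-injective P }

reverse : ∀ {G s t} → ℕPath G s t → ℕPath G t s
reverse {G} P = record
  { length           = n
  ; vertex           = λ i → vertex P (n ∸ i)
  ; edge             = λ i p → edge P (n ∸ suc i) (mirror (recompute (_ ≤? _) p))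
  ; vertex-0         = vertex-length P
  ; vertex-length    = trans (cong (vertex P) (n∸n≡0 n)) (vertex-0 P)
  ; edge-joins       = λ i p → let i<n = recompute (_ ≤? _) p in
                         Joins-sym {G} (subst (Joins G (edge P (n ∸ suc i) (mirror i<n)) (vertex P (n ∸ suc i)) ∘ vertex P)
                                              (suc[n∸suc[i]] i<n) (edge-joins P _ (mirror i<n)))
  ; vertex-injective = λ i j i≤ j≤ eq → ∸-cancelˡ-≡ i≤ j≤ (vertex-injective P _ _ (m∸n≤m n i) (m∸n≤m n j) eq)
  }
  where
  n = length P

  suc[n∸suc[i]] : ∀ {i} → suc i ≤ n → suc (n ∸ suc i) ≡ n ∸ i
  suc[n∸suc[i]] i<n = sym (+-∸-assoc 1 i<n)

  mirror : ∀ {i} → suc i ≤ n → suc (n ∸ suc i) ≤ n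
  mirror {i} i<n = subst (_≤ n) (sym (suc[n∸suc[i]] i<n)) (m∸n≤m n i)

module _ {G : Graph} {s t : Fin (V G)} (P : ℕPath G s t) where

  vertex-end : ∀ {k} → k ≡ length P → vertex P k ≡ t
  vertex-end k≡n = trans (cong (vertex P) k≡n) (vertex-length P)

  length-pos : s ≢ t → 1 ≤ length P
  length-pos s≢t with length P in n≡
  ... | zero  = ⊥-elim (s≢t (trans (sym (vertex-0 P)) (vertex-end (sym n≡))))
  ... | suc _ = s≤s z≤n

  edge-joins-from : ∀ {v} i .(p : suc i ≤ length P) → vertex P i ≡ v → Joins G (edge P i p) v (vertex P (suc i))
  edge-joins-from i p eq = subst (λ z → Joins G (edge P i p) z (vertex P (suc i))) eq (edge-joins P i p)

  edge-joins-into : ∀ {v} i .(p : suc i ≤ length P) → vertex P (suc i) ≡ v → Joins G (edge P i p) v (vertex P i)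
  edge-joins-into i p eq = subst (λ z → Joins G (edge P i p) z (vertex P i)) eq (Joins-sym {G} (edge-joins P i p))

  first-edge-joins : .(p : 1 ≤ length P) → Joins G (edge P 0 p) s (vertex P 1)
  first-edge-joins p = edge-joins-from 0 p (vertex-0 P)

Disjoint : ∀ {G s t s′ t′} → ℕPath G s t → ℕPath G s′ t′ → Set
Disjoint P Q = ∀ i .(p : suc i ≤ length P) j .(q : suc j ≤ length Q) → edge P i p ≢ edge Q j q

Disjoint-sym : ∀ {G s t s′ t′} (P : ℕPath G s t) (Q : ℕPath G s′ t′) → Disjoint P Q → Disjoint Q P
Disjoint-sym P Q d i p j q e = d j q i p (sym e)

-- a and b are the two vertices v′, v″ of one gadget and o is the vertex it hangs from;
-- only the edges at a and b are described.
record Gadget (G : Graph) : Set where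
  field
    a b o         : Fin (V G)
    ab₁ ab₂ ao bo : Fin (E G)
    a-neighbours  : ∀ x y → Joins G x a y → ((x ≡ ab₁ ⊎ x ≡ ab₂) × y ≡ b) ⊎ (x ≡ ao × y ≡ o)
    b-neighbours  : ∀ x y → Joins G x b y → ((x ≡ ab₁ ⊎ x ≡ ab₂) × y ≡ a) ⊎ (x ≡ bo × y ≡ o)

swapGadget : ∀ {G} → Gadget G → Gadget G
swapGadget K = record
  { a = b ; b = a ; o = o ; ab₁ = ab₁ ; ab₂ = ab₂ ; ao = bo ; bo = ao
  ; a-neighbours = b-neighbours ; b-neighbours = a-neighbours }
  where open Gadget K

module GadgetPaths {G : Graph} (K : Gadget G) where
  open Gadget K

  Doubled : Fin (E G) → Set
  Doubled x = x ≡ ab₁ ⊎ x ≡ ab₂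

  doubled-pigeonhole : ∀ {x y z} → Doubled x → Doubled y → Doubled z → x ≢ y → x ≢ z → y ≢ z → ⊥
  doubled-pigeonhole (inj₁ x) (inj₁ y) _        x≢y _   _   = x≢y (trans x (sym y))
  doubled-pigeonhole (inj₂ x) (inj₂ y) _        x≢y _   _   = x≢y (trans x (sym y))
  doubled-pigeonhole (inj₁ x) (inj₂ _) (inj₁ z) _   x≢z _   = x≢z (trans x (sym z))
  doubled-pigeonhole (inj₂ x) (inj₁ _) (inj₂ z) _   x≢z _   = x≢z (trans x (sym z))
  doubled-pigeonhole (inj₁ _) (inj₂ y) (inj₂ z) _   _   y≢z = y≢z (trans y (sym z))
  doubled-pigeonhole (inj₂ _) (inj₁ y) (inj₁ z) _   _   y≢z = y≢z (trans y (sym z))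

  a-neighbour : ∀ {x y} → Joins G x a y → y ≡ b ⊎ y ≡ o
  a-neighbour = Sum.map proj₂ proj₂ ∘ a-neighbours _ _

  b-neighbour : ∀ {x y} → Joins G x b y → y ≡ a ⊎ y ≡ o
  b-neighbour = Sum.map proj₂ proj₂ ∘ b-neighbours _ _

  Exit : (∀ {u} → ℕPath G b u → Set) → Set
  Exit Avoids = Σ (Fin (V G)) λ u → Σ (ℕPath G b u) λ Q → b ≢ u × Avoids Q

  exit-map : {R S : ∀ {u} → ℕPath G b u → Set} → (∀ {u} {Q : ℕPath G b u} → R Q → S Q) → Exit R → Exit S
  exit-map f (u , Q , b≢u , r) = u , Q , b≢u , f r

  Avoiding₂ : ∀ {t t′} → ℕPath G a t → ℕPath G a t′ → ∀ {u} → ℕPath G b u → Set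
  Avoiding₂ P P′ Q = Disjoint Q P × Disjoint Q P′

  data FirstStep {t} (P : ℕPath G a t) : Set where
    to-b : (p : 1 ≤ length P) → Doubled (edge P 0 p) → vertex P 1 ≡ b → FirstStep P
    to-o : (p : 1 ≤ length P) → edge P 0 p ≡ ao → FirstStep P

  first-step : ∀ {t} (P : ℕPath G a t) → a ≢ t → FirstStep P
  first-step P a≢t with p ← length-pos P a≢t with a-neighbours _ _ (first-edge-joins P p)
  ... | inj₁ (doubled , v₁≡b) = to-b p doubled v₁≡b
  ... | inj₂ (e≡ao , _)       = to-o p e≡ao

  after-b : ∀ {t} (P : ℕPath G a t) → 1 ≤ length P → vertex P 1 ≡ b →
            t ≡ b ⊎ Σ (2 ≤ length P) λ q → edge P 1 q ≡ bo
  after-b P p v₁≡b with m≤n⇒m<n∨m≡n p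
  ... | inj₂ 1≡n = inj₁ (trans (sym (vertex-end P 1≡n)) v₁≡b)
  ... | inj₁ q with b-neighbours _ _ (edge-joins-from P 1 q v₁≡b)
  ...   | inj₁ (_ , v₂≡a) with () ← vertex-injective P 2 0 q z≤n (trans v₂≡a (sym (vertex-0 P)))
  ...   | inj₂ (e≡bo , _) = inj₂ (q , e≡bo)

  -- Any exit from b starts with ab₁, ab₂ or bo, and P and P′ have used all three.
  exit-blocked : ∀ {t t′} (P : ℕPath G a t) (P′ : ℕPath G a t′) → Disjoint P P′ →
                 .(p : 1 ≤ length P) .(p′ : 1 ≤ length P′) → Doubled (edge P 0 p) → Doubled (edge P′ 0 p′) →
                 (q : 2 ≤ length P) → edge P 1 q ≡ bo → ¬ Exit (Avoiding₂ P P′)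
  exit-blocked P P′ d p p′ h h′ q e (u , Q , b≢u , dQP , dQP′)
    with r ← length-pos Q b≢u with b-neighbours _ _ (first-edge-joins Q r)
  ... | inj₂ (e≡bo , _)    = dQP 0 r 1 q (trans e≡bo (sym e))
  ... | inj₁ (doubled , _) = doubled-pigeonhole doubled h h′ (dQP 0 r 0 p) (dQP′ 0 r 0 p′) (d 0 p 0 p′)

  doubled-pair-impossible : ∀ {t t′} (P : ℕPath G a t) (P′ : ℕPath G a t′) → Disjoint P P′ → t ≢ t′ →
      (p : 1 ≤ length P) → Doubled (edge P 0 p) → vertex P 1 ≡ b →
      (p′ : 1 ≤ length P′) → Doubled (edge P′ 0 p′) → vertex P′ 1 ≡ b →
      (t ≡ b → Exit (Avoiding₂ P P′)) → (t′ ≡ b → Exit (Avoiding₂ P P′)) → ⊥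
  doubled-pair-impossible P P′ d t≢t′ p h v p′ h′ v′ exit exit′ with after-b P p v | after-b P′ p′ v′
  ... | inj₁ t≡b       | inj₁ t′≡b       = t≢t′ (trans t≡b (sym t′≡b))
  ... | inj₂ (q , e)   | inj₂ (q′ , e′)  = d 1 q 1 q′ (trans e (sym e′))
  ... | inj₂ (q , e)   | inj₁ t′≡b       = exit-blocked P P′ d p p′ h h′ q e (exit′ t′≡b)
  ... | inj₁ t≡b       | inj₂ (q′ , e′)  =
    exit-blocked P′ P (Disjoint-sym P P′ d) p′ p h′ h q′ e′ (exit-map swap (exit t≡b))

  no-three-paths-from-a : {t : Fin 3 → Fin (V G)} (P : ∀ i → ℕPath G a (t i)) →
      (∀ i → a ≢ t i) → (∀ i j → t i ≡ t j → i ≡ j) → (∀ i j → i ≢ j → Disjoint (P i) (P j)) →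
      (∀ i → t i ≡ b → Exit (λ Q → ∀ j → Disjoint Q (P j))) → ⊥
  no-three-paths-from-a P a≢t t-injective P-disjoint exit =
    three (first-step (P 0F) (a≢t 0F)) (first-step (P 1F) (a≢t 1F)) (first-step (P 2F) (a≢t 2F))
    where
    pair : ∀ i j → i ≢ j →
           (p : 1 ≤ length (P i)) → Doubled (edge (P i) 0 p) → vertex (P i) 1 ≡ b →
           (p′ : 1 ≤ length (P j)) → Doubled (edge (P j) 0 p′) → vertex (P j) 1 ≡ b → ⊥
    pair i j i≢j p h v p′ h′ v′ =
      doubled-pair-impossible (P i) (P j) (P-disjoint i j i≢j) (i≢j ∘ t-injective i j) p h v p′ h′ v′
        (exit-map (λ avoids → avoids i , avoids j) ∘ exit i) (exit-map (λ avoids → avoids i , avoids j) ∘ exit j)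

    three : FirstStep (P 0F) → FirstStep (P 1F) → FirstStep (P 2F) → ⊥
    three (to-o p e) (to-o p′ e′) _ = P-disjoint 0F 1F (λ ()) 0 p 0 p′ (trans e (sym e′))
    three (to-o p e) _ (to-o p′ e′) = P-disjoint 0F 2F (λ ()) 0 p 0 p′ (trans e (sym e′))
    three _ (to-o p e) (to-o p′ e′) = P-disjoint 1F 2F (λ ()) 0 p 0 p′ (trans e (sym e′))
    three (to-b p h v) (to-b p′ h′ v′) _           = pair 0F 1F (λ ()) p h v p′ h′ v′
    three (to-b p h v) (to-o _ _) (to-b p′ h′ v′)  = pair 0F 2F (λ ()) p h v p′ h′ v′
    three (to-o _ _) (to-b p h v) (to-b p′ h′ v′)  = pair 1F 2F (λ ()) p h v p′ h′ v′

  module _ {s t} (P : ℕPath G s t) where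
    private
      revisit : ∀ {i j v} → i ≤ length P → j ≤ length P → vertex P i ≡ v → vertex P j ≡ v → i ≡ j
      revisit i≤ j≤ vi vj = vertex-injective P _ _ i≤ j≤ (trans vi (sym vj))

      a-then-b : t ≢ b → ∀ m → suc (suc m) ≤ length P →
                 vertex P m ≡ o → vertex P (suc m) ≡ a → vertex P (suc (suc m)) ≡ b → ⊥
      a-then-b t≢b m le vo va vb with m≤n⇒m<n∨m≡n le
      ... | inj₂ eq = t≢b (trans (sym (vertex-end P eq)) vb)
      ... | inj₁ lt with b-neighbour (edge-joins-from P (suc (suc m)) lt vb)
      ...   | inj₁ v₃≡a = m≢1+n+m (suc m) {1} (revisit (<⇒≤ le) lt va v₃≡a)
      ...   | inj₂ v₃≡o = m≢1+n+m m {2} (revisit (<⇒≤ (<⇒≤ le)) lt vo v₃≡o)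

      b-then-a : s ≢ b → ∀ m → suc (suc m) ≤ length P →
                 vertex P m ≡ b → vertex P (suc m) ≡ a → vertex P (suc (suc m)) ≡ o → ⊥
      b-then-a s≢b zero     _  vb _  _  = s≢b (trans (sym (vertex-0 P)) vb)
      b-then-a s≢b (suc m) le vb va vo with b-neighbour (edge-joins-into P m (<⇒≤ (<⇒≤ le)) vb)
      ... | inj₁ vₘ≡a = m≢1+n+m m {1} (revisit (<⇒≤ (<⇒≤ (<⇒≤ le))) (<⇒≤ le) vₘ≡a va)
      ... | inj₂ vₘ≡o = m≢1+n+m m {2} (revisit (<⇒≤ (<⇒≤ (<⇒≤ le))) le vₘ≡o vo)

    -- Both neighbours of a on the path lie in {b, o}, and beyond b the path could only revisit a or o.
    path-avoids-a : s ≢ a → s ≢ b → t ≢ a → t ≢ b → ∀ k → k ≤ length P → vertex P k ≢ a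
    path-avoids-a s≢a _ _ _ zero _ vk = s≢a (trans (sym (vertex-0 P)) vk)
    path-avoids-a _ s≢b t≢a t≢b (suc m) le vk with m≤n⇒m<n∨m≡n le
    ... | inj₂ eq = t≢a (trans (sym (vertex-end P eq)) vk)
    ... | inj₁ lt with a-neighbour (edge-joins-into P m le vk) | a-neighbour (edge-joins-from P (suc m) lt vk)
    ...   | inj₁ vb | inj₁ vb′ = m≢1+n+m m {1} (revisit (<⇒≤ le) lt vb vb′)
    ...   | inj₂ vo | inj₂ vo′ = m≢1+n+m m {1} (revisit (<⇒≤ le) lt vo vo′)
    ...   | inj₂ vo | inj₁ vb  = a-then-b t≢b m lt vo vk vb
    ...   | inj₁ vb | inj₂ vo  = b-then-a s≢b m lt vb vk vo

module _ {H G : Graph} (I : Immersion H G) where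

  Route : Fin (E H) → Fin (V H) → Fin (V H) → Set
  Route x u w = Σ (ℕPath G (φ I u) (φ I w)) λ P →
    ∀ i .(p : suc i ≤ length P) → Σ (Fin (len (ψ I x))) λ j → edges (ψ I x) j ≡ edge P i p

  route : ∀ {x u w} → Joins H x u w → Route x u w
  route {x} (inj₁ eq) = castEnds (cong (φ I ∘ proj₁) eq) (cong (φ I ∘ proj₂) eq) (fromPath (ψ I x)) , λ _ _ → _ , refl
  route {x} (inj₂ eq) = reverse (castEnds (cong (φ I ∘ proj₁) eq) (cong (φ I ∘ proj₂) eq) (fromPath (ψ I x))) , λ _ _ → _ , refl

  routes-disjoint : ∀ {x y u w u′ w′} → x ≢ y → (R : Route x u w) (R′ : Route y u′ w′) → Disjoint (proj₁ R) (proj₁ R′)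
  routes-disjoint x≢y (P , inP) (P′ , inP′) i p j q e with inP i p | inP′ j q
  ... | (k , ek) | (l , el) = x≢y (disjoint I _ _ k l (trans ek (trans e (sym el))))

record SpurredClaw (H : Graph) (h : Fin (V H)) : Set where
  field
    leg            : Fin 3 → Fin (E H)
    foot           : Fin 3 → Fin (V H)
    leg-joins      : ∀ i → Joins H (leg i) h (foot i)
    h≢foot         : ∀ i → h ≢ foot i
    foot-injective : ∀ i j → foot i ≡ foot j → i ≡ j
    spur           : Fin 3 → Fin (E H)
    spur-end       : Fin 3 → Fin (V H)
    spur-joins     : ∀ i → Joins H (spur i) (foot i) (spur-end i)
    foot≢spur-end  : ∀ i → foot i ≢ spur-end i
    spur≢leg       : ∀ i j → spur i ≢ leg j

claw-centre-avoids-gadget : ∀ {H G h} (I : Immersion H G) → SpurredClaw H h → (K : Gadget G) → φ I h ≢ Gadget.a K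
claw-centre-avoids-gadget {H} {G} {h} I C K φh≡a =
  no-three-paths-from-a paths
    (λ i a≡ → h≢foot i (φ-inj I _ _ (trans φh≡a a≡)))
    (λ i j e → foot-injective i j (φ-inj I _ _ e))
    (λ i j i≢j → routes-disjoint I (legs-distinct i j i≢j) (legRoute i) (legRoute j))
    exit
  where
  open SpurredClaw C
  open Gadget K
  open GadgetPaths K

  legRoute : ∀ i → Route I (leg i) h (foot i)
  legRoute i = route I (leg-joins i)

  paths : ∀ i → ℕPath G a (φ I (foot i))
  paths i = castEnds φh≡a refl (proj₁ (legRoute i))

  legs-distinct : ∀ i j → i ≢ j → leg i ≢ leg j
  legs-distinct i j i≢j e = i≢j (foot-injective i j
    (Joins-functional {H} (h≢foot i) (leg-joins i) (subst (λ x → Joins H x h (foot j)) (sym e) (leg-joins j))))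

  exit : ∀ i → φ I (foot i) ≡ b → Exit (λ Q → ∀ j → Disjoint Q (paths j))
  exit i φfoot≡b =
    φ I (spur-end i) , castEnds φfoot≡b refl (proj₁ spurRoute) ,
    (λ b≡ → foot≢spur-end i (φ-inj I _ _ (trans φfoot≡b b≡))) ,
    (λ j → routes-disjoint I (spur≢leg i j) spurRoute (legRoute j))
    where
    spurRoute : Route I (spur i) (foot i) (spur-end i)
    spurRoute = route I (spur-joins i)

↑ˡ≢↑ʳ : ∀ {m n} {i : Fin m} {j : Fin n} → i ↑ˡ n ≢ m ↑ʳ j
↑ˡ≢↑ʳ {m} {n} {i} {j} e with trans (sym (splitAt-↑ˡ m i n)) (trans (cong (splitAt m) e) (splitAt-↑ʳ m n j))
... | ()

module Attach (G : Graph) (D : ℕ) (own : Fin D → Fin (V G)) where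

  G′ : Graph
  G′ = attach G D own

  base : Fin (V G) → Fin (V G′)
  base u = u ↑ˡ (D + D)

  v′ v″ : Fin D → Fin (V G′)
  v′ g = V G ↑ʳ (g ↑ˡ D)
  v″ g = V G ↑ʳ (D ↑ʳ g)

  baseE : Fin (E G) → Fin (E G′)
  baseE e = e ↑ˡ (D * 4)

  gadgetE : Fin D → Fin 4 → Fin (E G′)
  gadgetE g j = E G ↑ʳ combine g j

  IsBase : Fin (V G′) → Set
  IsBase t = Σ (Fin (V G)) λ u → base u ≡ t

  ends-baseE : ∀ e → ends G′ (baseE e) ≡ (base (proj₁ (ends G e)) , base (proj₂ (ends G e)))
  ends-baseE e rewrite splitAt-↑ˡ (E G) e (D * 4) = refl

  ends-gadgetE : ∀ g j → ends G′ (gadgetE g j) ≡ gadgetEdge own g j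
  ends-gadgetE g j rewrite splitAt-↑ʳ (E G) (D * 4) (combine g j) =
    cong (λ gj → gadgetEdge own (proj₁ gj) (proj₂ gj)) (remQuot-combine g j)

  edge-view : ∀ x → (Σ (Fin (E G)) λ e → baseE e ≡ x) ⊎ (Σ (Fin D) λ g → Σ (Fin 4) λ j → gadgetE g j ≡ x)
  edge-view x with splitAt (E G) x in eq
  ... | inj₁ e = inj₁ (e , splitAt⁻¹-↑ˡ eq)
  ... | inj₂ y = inj₂ (proj₁ (remQuot {D} 4 y) , proj₂ (remQuot {D} 4 y) ,
                       trans (cong (E G ↑ʳ_) (combine-remQuot {D} 4 y)) (splitAt⁻¹-↑ʳ eq))

  vertex-view : ∀ t → IsBase t ⊎ ((Σ (Fin D) λ g → v′ g ≡ t) ⊎ (Σ (Fin D) λ g → v″ g ≡ t))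
  vertex-view t with splitAt (V G) t in eq
  ... | inj₁ u = inj₁ (u , splitAt⁻¹-↑ˡ eq)
  ... | inj₂ s with splitAt D s in eq′
  ...   | inj₁ g = inj₂ (inj₁ (g , trans (cong (V G ↑ʳ_) (splitAt⁻¹-↑ˡ eq′)) (splitAt⁻¹-↑ʳ eq)))
  ...   | inj₂ g = inj₂ (inj₂ (g , trans (cong (V G ↑ʳ_) (splitAt⁻¹-↑ʳ eq′)) (splitAt⁻¹-↑ʳ eq)))

  base-injective : ∀ {u w} → base u ≡ base w → u ≡ w
  base-injective = ↑ˡ-injective (D + D) _ _

  baseE-injective : ∀ {e f} → baseE e ≡ baseE f → e ≡ f
  baseE-injective = ↑ˡ-injective (D * 4) _ _

  gadgetE-injective : ∀ {g j g′ j′} → gadgetE g j ≡ gadgetE g′ j′ → g ≡ g′ × j ≡ j′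
  gadgetE-injective e = combine-injective _ _ _ _ (↑ʳ-injective (E G) _ _ e)

  v′-injective : ∀ {g g′} → v′ g ≡ v′ g′ → g ≡ g′
  v′-injective e = ↑ˡ-injective D _ _ (↑ʳ-injective (V G) _ _ e)

  v″-injective : ∀ {g g′} → v″ g ≡ v″ g′ → g ≡ g′
  v″-injective e = ↑ʳ-injective D _ _ (↑ʳ-injective (V G) _ _ e)

  v′≢v″ : ∀ {g g′} → v′ g ≢ v″ g′
  v′≢v″ = ↑ˡ≢↑ʳ ∘ ↑ʳ-injective (V G) _ _

  base≢v′ : ∀ {u g} → base u ≢ v′ g
  base≢v′ = ↑ˡ≢↑ʳ

  base≢v″ : ∀ {u g} → base u ≢ v″ g
  base≢v″ = ↑ˡ≢↑ʳ

  baseE≢gadgetE : ∀ {e g j} → baseE e ≢ gadgetE g j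
  baseE≢gadgetE = ↑ˡ≢↑ʳ

  joins-lift : ∀ {e a b} → Joins G e a b → Joins G′ (baseE e) (base a) (base b)
  joins-lift {e} = Sum.map lift lift
    where
    lift : ∀ {a b} → ends G e ≡ (a , b) → ends G′ (baseE e) ≡ (base a , base b)
    lift eq = trans (ends-baseE e) (cong (λ ab → base (proj₁ ab) , base (proj₂ ab)) eq)

  joins-lower : ∀ {e a b} → Joins G′ (baseE e) (base a) (base b) → Joins G e a b
  joins-lower {e} J = Sum.map lower lower (Joins-ends {G′} (ends-baseE e) J)
    where
    lower : ∀ {a b} → (base (proj₁ (ends G e)) , base (proj₂ (ends G e))) ≡ (base a , base b) → ends G e ≡ (a , b)
    lower eq = cong₂ _,_ (base-injective (cong proj₁ eq)) (base-injective (cong proj₂ eq))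

  private
    v′-neighbours : ∀ g g₀ j y → gadgetEdge own g₀ j ≡ (v′ g , y) ⊎ gadgetEdge own g₀ j ≡ (y , v′ g) →
                    ((gadgetE g₀ j ≡ gadgetE g 0F ⊎ gadgetE g₀ j ≡ gadgetE g 1F) × y ≡ v″ g) ⊎
                    (gadgetE g₀ j ≡ gadgetE g 2F × y ≡ base (own g))
    v′-neighbours g g₀ 0F y (inj₁ eq) with refl ← v′-injective (cong proj₁ eq) = inj₁ (inj₁ refl , sym (cong proj₂ eq))
    v′-neighbours g g₀ 1F y (inj₁ eq) with refl ← v′-injective (cong proj₁ eq) = inj₁ (inj₂ refl , sym (cong proj₂ eq))
    v′-neighbours g g₀ 2F y (inj₂ eq) with refl ← v′-injective (cong proj₂ eq) = inj₂ (refl , sym (cong proj₁ eq))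
    v′-neighbours g g₀ 0F y (inj₂ eq) = ⊥-elim (v′≢v″ (sym (cong proj₂ eq)))
    v′-neighbours g g₀ 1F y (inj₂ eq) = ⊥-elim (v′≢v″ (sym (cong proj₂ eq)))
    v′-neighbours g g₀ 2F y (inj₁ eq) = ⊥-elim (base≢v′ (cong proj₁ eq))
    v′-neighbours g g₀ 3F y (inj₁ eq) = ⊥-elim (base≢v′ (cong proj₁ eq))
    v′-neighbours g g₀ 3F y (inj₂ eq) = ⊥-elim (v′≢v″ (sym (cong proj₂ eq)))

    v″-neighbours : ∀ g g₀ j y → gadgetEdge own g₀ j ≡ (v″ g , y) ⊎ gadgetEdge own g₀ j ≡ (y , v″ g) →
                    ((gadgetE g₀ j ≡ gadgetE g 0F ⊎ gadgetE g₀ j ≡ gadgetE g 1F) × y ≡ v′ g) ⊎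
                    (gadgetE g₀ j ≡ gadgetE g 3F × y ≡ base (own g))
    v″-neighbours g g₀ 0F y (inj₂ eq) with refl ← v″-injective (cong proj₂ eq) = inj₁ (inj₁ refl , sym (cong proj₁ eq))
    v″-neighbours g g₀ 1F y (inj₂ eq) with refl ← v″-injective (cong proj₂ eq) = inj₁ (inj₂ refl , sym (cong proj₁ eq))
    v″-neighbours g g₀ 3F y (inj₂ eq) with refl ← v″-injective (cong proj₂ eq) = inj₂ (refl , sym (cong proj₁ eq))
    v″-neighbours g g₀ 0F y (inj₁ eq) = ⊥-elim (v′≢v″ (cong proj₁ eq))
    v″-neighbours g g₀ 1F y (inj₁ eq) = ⊥-elim (v′≢v″ (cong proj₁ eq))
    v″-neighbours g g₀ 2F y (inj₁ eq) = ⊥-elim (base≢v″ (cong proj₁ eq))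
    v″-neighbours g g₀ 2F y (inj₂ eq) = ⊥-elim (v′≢v″ (cong proj₂ eq))
    v″-neighbours g g₀ 3F y (inj₁ eq) = ⊥-elim (base≢v″ (cong proj₁ eq))

    baseE-avoids : ∀ {e y t} → (∀ {u} → base u ≢ t) → ¬ Joins G′ (baseE e) t y
    baseE-avoids {e} t-not-base J with Joins-ends {G′} (ends-baseE e) J
    ... | inj₁ eq = t-not-base (cong proj₁ eq)
    ... | inj₂ eq = t-not-base (cong proj₂ eq)

  gadget : Fin D → Gadget G′
  gadget g = record
    { a = v′ g ; b = v″ g ; o = base (own g)
    ; ab₁ = gadgetE g 0F ; ab₂ = gadgetE g 1F ; ao = gadgetE g 2F ; bo = gadgetE g 3F
    ; a-neighbours = a-neighbours ; b-neighbours = b-neighbours }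
    where
    a-neighbours : ∀ x y → Joins G′ x (v′ g) y →
                   ((x ≡ gadgetE g 0F ⊎ x ≡ gadgetE g 1F) × y ≡ v″ g) ⊎ (x ≡ gadgetE g 2F × y ≡ base (own g))
    a-neighbours x y J with edge-view x
    ... | inj₁ (e , refl)      = ⊥-elim (baseE-avoids base≢v′ J)
    ... | inj₂ (g₀ , j , refl) = v′-neighbours g g₀ j y (Joins-ends {G′} (ends-gadgetE g₀ j) J)

    b-neighbours : ∀ x y → Joins G′ x (v″ g) y →
                   ((x ≡ gadgetE g 0F ⊎ x ≡ gadgetE g 1F) × y ≡ v′ g) ⊎ (x ≡ gadgetE g 3F × y ≡ base (own g))
    b-neighbours x y J with edge-view x
    ... | inj₁ (e , refl)      = ⊥-elim (baseE-avoids base≢v″ J)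
    ... | inj₂ (g₀ , j , refl) = v″-neighbours g g₀ j y (Joins-ends {G′} (ends-gadgetE g₀ j) J)

  path-stays-in-base : ∀ {s t} (P : ℕPath G′ s t) → IsBase s → IsBase t → ∀ k → k ≤ length P → IsBase (vertex P k)
  path-stays-in-base P (_ , refl) (_ , refl) k k≤n with vertex-view (vertex P k)
  ... | inj₁ based = based
  ... | inj₂ (inj₁ (g , e)) =
    ⊥-elim (GadgetPaths.path-avoids-a (gadget g) P base≢v′ base≢v″ base≢v′ base≢v″ k k≤n (sym e))
  ... | inj₂ (inj₂ (g , e)) =
    ⊥-elim (GadgetPaths.path-avoids-a (swapGadget (gadget g)) P base≢v″ base≢v′ base≢v″ base≢v′ k k≤n (sym e))

  private
    gadgetEdge-second-end : ∀ g j u → proj₂ (gadgetEdge own g j) ≢ base u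
    gadgetEdge-second-end g 0F u e = base≢v″ (sym e)
    gadgetEdge-second-end g 1F u e = base≢v″ (sym e)
    gadgetEdge-second-end g 2F u e = base≢v′ (sym e)
    gadgetEdge-second-end g 3F u e = base≢v″ (sym e)

  edge-between-bases : ∀ x u w → Joins G′ x (base u) (base w) → Σ (Fin (E G)) λ e → baseE e ≡ x
  edge-between-bases x u w J with edge-view x
  ... | inj₁ based = based
  ... | inj₂ (g , j , refl) with Joins-ends {G′} (ends-gadgetE g j) J
  ...   | inj₁ eq = ⊥-elim (gadgetEdge-second-end g j w (cong proj₂ eq))
  ...   | inj₂ eq = ⊥-elim (gadgetEdge-second-end g j u (cong proj₂ eq))

  module _ {s t} (P : Path G′ s t) (s′ : IsBase s) (t′ : IsBase t) where
    private
      vertex-base : ∀ k → IsBase (verts P k)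
      vertex-base k = subst IsBase (lookupℕ-toℕ (len P) (verts P) k)
                        (path-stays-in-base (fromPath P) s′ t′ (toℕ k) (toℕ≤pred[n] k))

      edge-base : ∀ i → Σ (Fin (E G)) λ e → baseE e ≡ edges P i
      edge-base i = edge-between-bases (edges P i) _ _
        (subst₂ (Joins G′ (edges P i)) (sym (proj₂ (vertex-base (inject₁ i)))) (sym (proj₂ (vertex-base (suc i)))) (joins P i))

    restrictPath : Path G (proj₁ s′) (proj₁ t′)
    restrictPath = record
      { len      = len P
      ; verts    = proj₁ ∘ vertex-base
      ; edges    = proj₁ ∘ edge-base
      ; start    = base-injective (trans (proj₂ (vertex-base zero)) (trans (start P) (sym (proj₂ s′))))
      ; end      = base-injective (trans (proj₂ (vertex-base (fromℕ (len P)))) (trans (end P) (sym (proj₂ t′))))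
      ; joins    = λ i → joins-lower (Joins-cong {G′} (sym (proj₂ (edge-base i))) (sym (proj₂ (vertex-base (inject₁ i))))
                                                 (sym (proj₂ (vertex-base (suc i)))) (joins P i))
      ; distinct = λ i j eq → distinct P i j (trans (sym (proj₂ (vertex-base i))) (trans (cong base eq) (proj₂ (vertex-base j))))
      }

    restrictPath-edges : ∀ i → baseE (edges restrictPath i) ≡ edges P i
    restrictPath-edges i = proj₂ (edge-base i)

has-neighbour : ∀ {H} → Connected H → 1 ≤ E H → ∀ v → Σ (Fin (E H)) λ e → Σ (Fin (V H)) λ w → Joins H e v w
has-neighbour {H} connected nonempty v = neighbour (v ≟ x₀)
  where
  e₀ = fromℕ< nonempty
  x₀ = proj₁ (ends H e₀)

  neighbour : Dec (v ≡ x₀) → Σ (Fin (E H)) λ e → Σ (Fin (V H)) λ w → Joins H e v w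
  neighbour (yes v≡x₀) = e₀ , proj₂ (ends H e₀) , inj₁ (cong (_, proj₂ (ends H e₀)) (sym v≡x₀))
  neighbour (no v≢x₀)  = edge P 0 p , vertex P 1 , first-edge-joins P p
    where
    P = fromPath (connected v x₀)
    p = length-pos P v≢x₀

module _ {H : Graph} (loopless : Loopless H) (connected : Connected H) (nonempty : 1 ≤ E H) where
  open Attach H (V H) (λ u → u)

  plus-claw : ∀ v → SpurredClaw (H ⁺) (base v)
  plus-claw v = record
    { leg            = leg
    ; foot           = foot
    ; leg-joins      = λ { 0F → inj₁ (ends-gadgetE v 2F) ; 1F → inj₁ (ends-gadgetE v 3F) ; 2F → joins-lift e-joins }
    ; h≢foot         = λ { 0F → base≢v′ ; 1F → base≢v″ ; 2F → v≢w ∘ base-injective }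
    ; foot-injective = foot-injective
    ; spur           = spur
    ; spur-end       = λ { 0F → v″ v ; 1F → v′ v ; 2F → v′ w }
    ; spur-joins     = λ { 0F → inj₁ (ends-gadgetE v 0F) ; 1F → inj₂ (ends-gadgetE v 0F) ; 2F → inj₁ (ends-gadgetE w 2F) }
    ; foot≢spur-end  = λ { 0F → v′≢v″ ; 1F → v′≢v″ ∘ sym ; 2F → base≢v′ }
    ; spur≢leg       = spur≢leg
    }
    where
    e = proj₁ (has-neighbour connected nonempty v)
    w = proj₁ (proj₂ (has-neighbour connected nonempty v))

    e-joins : Joins H e v w
    e-joins = proj₂ (proj₂ (has-neighbour connected nonempty v))

    v≢w : v ≢ w
    v≢w = Joins-irrefl loopless e-joins

    leg spur : Fin 3 → Fin (E (H ⁺))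
    leg 0F = gadgetE v 2F
    leg 1F = gadgetE v 3F
    leg 2F = baseE e
    spur 0F = gadgetE v 0F
    spur 1F = gadgetE v 0F
    spur 2F = gadgetE w 2F

    foot : Fin 3 → Fin (V (H ⁺))
    foot 0F = v′ v
    foot 1F = v″ v
    foot 2F = base w

    foot-injective : ∀ i j → foot i ≡ foot j → i ≡ j
    foot-injective 0F 0F _  = refl
    foot-injective 1F 1F _  = refl
    foot-injective 2F 2F _  = refl
    foot-injective 0F 1F eq = ⊥-elim (v′≢v″ eq)
    foot-injective 1F 0F eq = ⊥-elim (v′≢v″ (sym eq))
    foot-injective 0F 2F eq = ⊥-elim (base≢v′ (sym eq))
    foot-injective 2F 0F eq = ⊥-elim (base≢v′ eq)
    foot-injective 1F 2F eq = ⊥-elim (base≢v″ (sym eq))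
    foot-injective 2F 1F eq = ⊥-elim (base≢v″ eq)

    spur≢leg : ∀ i j → spur i ≢ leg j
    spur≢leg 0F 0F = (λ ()) ∘ proj₂ ∘ gadgetE-injective
    spur≢leg 0F 1F = (λ ()) ∘ proj₂ ∘ gadgetE-injective
    spur≢leg 1F 0F = (λ ()) ∘ proj₂ ∘ gadgetE-injective
    spur≢leg 1F 1F = (λ ()) ∘ proj₂ ∘ gadgetE-injective
    spur≢leg 2F 0F = v≢w ∘ sym ∘ proj₁ ∘ gadgetE-injective
    spur≢leg 2F 1F = (λ ()) ∘ proj₂ ∘ gadgetE-injective
    spur≢leg 0F 2F = baseE≢gadgetE ∘ sym
    spur≢leg 1F 2F = baseE≢gadgetE ∘ sym
    spur≢leg 2F 2F = baseE≢gadgetE ∘ sym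

module _ {H G : Graph} {D : ℕ} {own : Fin D → Fin (V G)}
         (loopless : Loopless H) (connected : Connected H) (nonempty : 1 ≤ E H) where
  private
    module H⁺ = Attach H (V H) (λ u → u)
    module G′ = Attach G D own

    claw : ∀ v → SpurredClaw (H ⁺) (H⁺.base v)
    claw = plus-claw loopless connected nonempty

  module Restriction (I : Immersion (H ⁺) (attach G D own)) where

    base-to-base : ∀ v → G′.IsBase (φ I (H⁺.base v))
    base-to-base v with G′.vertex-view (φ I (H⁺.base v))
    ... | inj₁ based          = based
    ... | inj₂ (inj₁ (g , e)) = ⊥-elim (claw-centre-avoids-gadget I (claw v) (G′.gadget g) (sym e))
    ... | inj₂ (inj₂ (g , e)) = ⊥-elim (claw-centre-avoids-gadget I (claw v) (swapGadget (G′.gadget g)) (sym e))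

    φ′ : Fin (V H) → Fin (V G)
    φ′ = proj₁ ∘ base-to-base

    image-at-base : ∀ {x} v → H⁺.base v ≡ x → G′.IsBase (φ I x)
    image-at-base v eq = φ′ v , trans (proj₂ (base-to-base v)) (cong (φ I) eq)

    source : ∀ e → G′.IsBase (φ I (proj₁ (ends (H ⁺) (H⁺.baseE e))))
    source e = image-at-base _ (cong proj₁ (sym (H⁺.ends-baseE e)))

    target : ∀ e → G′.IsBase (φ I (proj₂ (ends (H ⁺) (H⁺.baseE e))))
    target e = image-at-base _ (cong proj₂ (sym (H⁺.ends-baseE e)))

    ψ′ : (e : Fin (E H)) → Path G (φ′ (proj₁ (ends H e))) (φ′ (proj₂ (ends H e)))
    ψ′ e = G′.restrictPath (ψ I (H⁺.baseE e)) (source e) (target e)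

    ψ′-edges : ∀ e i → G′.baseE (edges (ψ′ e) i) ≡ edges (ψ I (H⁺.baseE e)) i
    ψ′-edges e = G′.restrictPath-edges (ψ I (H⁺.baseE e)) (source e) (target e)

    immersion : Immersion H G
    immersion = record
      { φ        = φ′
      ; φ-inj    = λ u w eq → H⁺.base-injective (φ-inj I _ _
                     (trans (sym (proj₂ (base-to-base u))) (trans (cong G′.base eq) (proj₂ (base-to-base w)))))
      ; ψ        = ψ′
      ; disjoint = λ e f i j eq → H⁺.baseE-injective (disjoint I _ _ i j
                     (trans (sym (ψ′-edges e i)) (trans (cong G′.baseE eq) (ψ′-edges f j))))
      }

  restrictPacking : ∀ {p} → Packing (H ⁺) (attach G D own) p → Packing H G p
  restrictPacking (I , I-disjoint) = Restriction.immersion ∘ I , λ a b a≢b x (e , i , ex) (f , j , fx) →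
    I-disjoint a b a≢b (G′.baseE x)
      (H⁺.baseE e , i , trans (sym (Restriction.ψ′-edges (I a) e i)) (cong G′.baseE ex))
      (H⁺.baseE f , j , trans (sym (Restriction.ψ′-edges (I b) f j)) (cong G′.baseE fx))

lemma6 : (H G : Graph) → Loopless H → Loopless G →
         Connected H → 1 ≤ E H →
         ∀ (p q : ℕ) → IsPack (H ⁺) (G *) p → IsPack H G q → p ≤ q
lemma6 H G loopless _ connected nonempty p q (packing , _) (_ , maximal) =
  maximal p (restrictPacking loopless connected nonempty packing)
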